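{- For each $k\in\mathbb{Z}^+$, there are at most $168^k k^{4k+2}$ implementable strength-free TAS's with at most $k$ tile types.
   Context: Let $D_{\mathrm{all}}=\{\mathrm{N},\mathrm{S},\mathrm{E},\mathrm{W}\}$. A tile type is a map $t:D_{\mathrm{all}}\to\Lambda$ assigning a glue label to each side. Standing assumption: in a tile set $T$, every glue label occurring on some tile type in some direction also occurs on some tile type in the opposite direction; tile sets are counted up to renaming of glue labels, and the seed is a single tile, specified by its tile type. A strength-free TAS is a triple $(T,\sigma,\mathcal{D})$ with $T$ a finite set of tile types, $\sigma$ a single-tile seed of a type in $T$, and $\mathcal{D}$ assigning to each $t\in T$ a collection $\mathcal{D}(t)$ of subsets of $D_{\mathrm{all}}$ (its cooperation set). For a strength function $g$ (nonnegative integer strength for each glue label) and temperature $\tau\in\mathbb{Z}^+$, the cooperation set of $t$ is $\mathcal{D}_{g,\tau}(t)=\{D\subseteq D_{\mathrm{all}}:\sum_{d\in D}g(t(d))\ge\tau\}$. A strength-free TAS $(T,\sigma,\mathcal{D})$ is implementable if there exist $g:\Lambda(T)\to\mathbb{N}$ and $\tau\in\mathbb{Z}^+$ with $\mathcal{D}_{g,\tau}(t)=\mathcal{D}(t)$ for all $t\in T$. -}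

module Defs where

open import Data.Nat using (ℕ; _+_; _≤_; _*_; _^_)
open import Data.Bool using (Bool; true; false; if_then_else_)
open import Data.Fin using (Fin)
open import Data.Fin.Permutation using (Permutation; _⟨$⟩ʳ_)
open import Data.Product using (Σ; ∃; ∃-syntax; _×_)
open import Data.List using (List; length)
open import Data.List.Relation.Unary.Any using (Any)
open import Function.Definitions using (Injective)
open import Function.Bundles using (_⇔_)
open import Relation.Binary.PropositionalEquality using (_≡_)

data Dir : Set where
  N S E W : Dir

opp : Dir → Dir
opp N = S
opp S = N
opp E = W
opp W = E

-- Glue labels are natural numbers (any finite label set can be renamed into ℕ;
-- TASs are counted up to renaming of glue labels anyway).
Glue : Set
Glue = ℕ

TileType : Set
TileType = Dir → Glue

DirSet : Set
DirSet = Dir → Bool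

Coop : Set
Coop = DirSet → Bool

-- A strength-free TAS (T, σ, 𝒟): the tile set T is given as an indexed family
-- of pairwise distinct tile types, the seed is (the type of) one of its tiles,
-- and coop assigns the cooperation set 𝒟(t) to each tile type t ∈ T.
record SFTAS : Set where
  field
    size     : ℕ
    tile     : Fin size → TileType
    distinct : ∀ i j → (∀ d → tile i d ≡ tile j d) → i ≡ j
    seed     : Fin size
    coop     : Fin size → Coop
open SFTAS public

StandingAssumption : SFTAS → Set
StandingAssumption 𝒯 =
  ∀ i d → ∃[ j ] (tile 𝒯 j (opp d) ≡ tile 𝒯 i d)

strengthSum : (Glue → ℕ) → TileType → DirSet → ℕ
strengthSum g t D =
  (if D N then g (t N) else 0) + (if D S then g (t S) else 0) +
  (if D E then g (t E) else 0) + (if D W then g (t W) else 0)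

Implementable : SFTAS → Set
Implementable 𝒯 =
  Σ (Glue → ℕ) λ g → Σ ℕ λ τ → (1 ≤ τ) ×
    (∀ i (D : DirSet) → (coop 𝒯 i D ≡ true) ⇔ (τ ≤ strengthSum g (tile 𝒯 i) D))

-- Two strength-free TASs are the same up to renaming of glue labels
-- (an injective renaming ρ) and reindexing of the tile set (a bijection π).
Equiv : SFTAS → SFTAS → Set
Equiv A B =
  Σ (Glue → Glue) λ ρ → Injective _≡_ _≡_ ρ ×
  Σ (Permutation (size A) (size B)) λ π →
    (∀ i d → tile B (π ⟨$⟩ʳ i) d ≡ ρ (tile A i d)) ×
    (seed B ≡ π ⟨$⟩ʳ seed A) ×
    (∀ i D → coop B (π ⟨$⟩ʳ i) D ≡ coop A i D)

-- "There are at most n (classes of) implementable strength-free TASs with at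
-- most k tile types": some list of at most n TASs contains a representative
-- of every such TAS.
AtMostImplementable : ℕ → ℕ → Set
AtMostImplementable n k =
  Σ (List SFTAS) λ L → (length L ≤ n) ×
    (∀ 𝒯 → size 𝒯 ≤ k → StandingAssumption 𝒯 → Implementable 𝒯 → Any (Equiv 𝒯) L)

-- The proof encodes every such TAS by a code from an explicit finite list.
-- Reindex the tiles so that the seed comes first and relabel every glue by
-- the position of its first occurrence in the sequence N₀, E₀, N₁, E₁, … of
-- north and east glues; then tile j has north label < 2j+1 and east label
-- < 2j+2.  By the standing assumption each south (west) glue is the north
-- (east) glue of some tile, so it is recorded as a pointer to that tile.
-- Implementability makes each cooperation set a threshold function of the
-- four sides, hence one of the 168 monotone Boolean functions of 4 variables
-- (one of the 20 symmetric ones if there is a single tile).  Decoding a code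
-- gives back the TAS up to equivalence, and there are at most (2n)! (n²·168)^n
-- codes for n tiles; summing over n ≤ k gives the bound via (2n)! ≤ 2 n^(2n).
module Submission where

open import Defs
open import Data.Nat using (ℕ; zero; suc; _+_; _*_; _^_; _!; _≤_; _<_; _≤?_; z≤n; s≤s; s≤s⁻¹)
import Data.Nat as ℕ
open import Data.Nat.Properties
open import Data.Nat.Tactic.RingSolver using (solve-∀)
open import Data.Bool using (Bool; true; false; if_then_else_; f≤t; b≤b) renaming (_≤_ to _≤ᴮ_)
import Data.Bool.Properties as Boolₚ
open import Data.Fin using (Fin; zero; suc; toℕ)
open import Data.Fin.Properties using (all?) renaming (_≟_ to _≟ᶠ_)
open import Data.Fin.Permutation using (Permutation; _⟨$⟩ʳ_; _⟨$⟩ˡ_; inverseˡ; inverseʳ; transpose)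
open import Data.Vec using (Vec; []; _∷_; lookup; tabulate)
open import Data.Vec.Properties using (lookup∘tabulate)
open import Data.Vec.Relation.Binary.Pointwise.Inductive using (Pointwise; []; _∷_)
import Data.Vec.Relation.Binary.Pointwise.Inductive as Pointwise
open import Data.List
  using (List; []; _∷_; _++_; map; filter; upTo; allFin; cartesianProduct; cartesianProductWith; length)
open import Data.List.Properties using (length-map; length-++; length-upTo; length-tabulate)
open import Data.List.Membership.Propositional using (_∈_; lose)
open import Data.List.Membership.Propositional.Properties
  using (∈-map⁺; ∈-filter⁺; ∈-cartesianProduct⁺; ∈-cartesianProductWith⁺; ∈-upTo⁺; ∈-allFin)
open import Data.List.Relation.Unary.Any using (Any; here; there)
open import Data.List.Relation.Unary.Any.Properties using (++⁺ˡ; ++⁺ʳ)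
open import Data.Product using (_×_; _,_; proj₁; proj₂; uncurry)
open import Data.Sum using (inj₁; inj₂)
open import Function using (_$_)
open import Function.Bundles using (_⇔_; Equivalence)
open import Function.Definitions using (Injective)
open import Relation.Nullary using (Dec; yes; no; does; _×-dec_; _→-dec_)
open import Relation.Nullary.Decidable using (map′; dec-true)
open import Relation.Nullary.Negation using (contradiction)
open import Relation.Binary.PropositionalEquality

private variable n : ℕ

*-left-commute : ∀ a b c → a * (b * c) ≡ b * (a * c)
*-left-commute = solve-∀

^-distribʳ-* : ∀ a b n → (a * b) ^ n ≡ a ^ n * b ^ n
^-distribʳ-* a b zero    = refl
^-distribʳ-* a b (suc n) = begin
  a * b * (a * b) ^ n       ≡⟨ cong (a * b *_) (^-distribʳ-* a b n) ⟩
  a * b * (a ^ n * b ^ n)   ≡⟨ interchange a b (a ^ n) (b ^ n) ⟩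
  a * a ^ n * (b * b ^ n)   ∎
  where
  open ≡-Reasoning
  interchange : ∀ a b x y → a * b * (x * y) ≡ a * x * (b * y)
  interchange = solve-∀

bernoulli : ∀ m j → m ^ j * (m + j) ≤ m * suc m ^ j
bernoulli m zero    = ≤-reflexive (unit m)
  where
  unit : ∀ m → 1 * (m + 0) ≡ m * 1
  unit = solve-∀
bernoulli m (suc j) = begin
  m * m ^ j * (m + suc j)                  ≡⟨ expand m (m ^ j) j ⟩
  m ^ j * (m + j) * m + m ^ j * m          ≤⟨ +-monoʳ-≤ (m ^ j * (m + j) * m) (*-monoʳ-≤ (m ^ j) (m≤m+n m j)) ⟩
  m ^ j * (m + j) * m + m ^ j * (m + j)    ≡⟨ collect (m ^ j * (m + j)) m ⟩
  suc m * (m ^ j * (m + j))                ≤⟨ *-monoʳ-≤ (suc m) (bernoulli m j) ⟩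
  suc m * (m * suc m ^ j)                  ≡⟨ *-left-commute (suc m) m (suc m ^ j) ⟩
  m * (suc m * suc m ^ j)                  ∎
  where
  open ≤-Reasoning
  expand : ∀ m x j → m * x * (m + suc j) ≡ x * (m + j) * m + x * m
  expand = solve-∀
  collect : ∀ y m → y * m + y ≡ suc m * y
  collect = solve-∀

twice-power-bound : ∀ m → 1 ≤ m → 2 * m ^ m ≤ suc m ^ m
twice-power-bound m@(suc _) _ = *-cancelˡ-≤ m (begin
  m * (2 * m ^ m)   ≡⟨ rearrange (m ^ m) m ⟩
  m ^ m * (m + m)   ≤⟨ bernoulli m m ⟩
  m * suc m ^ m     ∎)
  where
  open ≤-Reasoning
  rearrange : ∀ x m → m * (2 * x) ≡ x * (m + m)
  rearrange = solve-∀

double-factorial-suc : ∀ m → (2 * suc m) ! ≡ (2 + 2 * m) * ((1 + 2 * m) * (2 * m) !)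
double-factorial-suc m = cong _! (*-suc 2 m)

-- (2n)! ≤ 2 n^(2n), by induction: a step multiplies the left side by
-- (2n+1)(2n+2) ≤ 4 (n+1)², and 4 n^(2n) ≤ (n+1)^(2n) by Bernoulli.
double-factorial-bound : ∀ n → (2 * n) ! ≤ 2 * (n * n) ^ n
double-factorial-bound zero            = s≤s z≤n
double-factorial-bound (suc zero)      = ≤-refl
double-factorial-bound (suc m@(suc _)) = begin
  (2 * suc m) !                                       ≡⟨ double-factorial-suc m ⟩
  (2 + 2 * m) * ((1 + 2 * m) * (2 * m) !)             ≡⟨ *-left-commute (2 + 2 * m) (1 + 2 * m) ((2 * m) !) ⟩
  (1 + 2 * m) * ((2 + 2 * m) * (2 * m) !)             ≤⟨ *-monoˡ-≤ ((2 + 2 * m) * (2 * m) !) (n≤1+n (1 + 2 * m)) ⟩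
  (2 + 2 * m) * ((2 + 2 * m) * (2 * m) !)             ≤⟨ *-monoʳ-≤ (2 + 2 * m) (*-monoʳ-≤ (2 + 2 * m) (double-factorial-bound m)) ⟩
  (2 + 2 * m) * ((2 + 2 * m) * (2 * (m * m) ^ m))     ≡⟨ cong (λ x → (2 + 2 * m) * ((2 + 2 * m) * (2 * x))) (^-distribʳ-* m m m) ⟩
  (2 + 2 * m) * ((2 + 2 * m) * (2 * (m ^ m * m ^ m))) ≡⟨ regroup (m ^ m) m ⟩
  2 * (suc m * suc m) * ((2 * m ^ m) * (2 * m ^ m))   ≤⟨ *-monoʳ-≤ (2 * (suc m * suc m)) (*-mono-≤ twice twice) ⟩
  2 * (suc m * suc m) * (suc m ^ m * suc m ^ m)       ≡⟨ cong (2 * (suc m * suc m) *_) (^-distribʳ-* (suc m) (suc m) m) ⟨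
  2 * (suc m * suc m) * (suc m * suc m) ^ m           ≡⟨ *-assoc 2 (suc m * suc m) ((suc m * suc m) ^ m) ⟩
  2 * (suc m * suc m) ^ suc m                         ∎
  where
  open ≤-Reasoning
  twice : 2 * m ^ m ≤ suc m ^ m
  twice = twice-power-bound m (s≤s z≤n)
  regroup : ∀ x m → (2 + 2 * m) * ((2 + 2 * m) * (2 * (x * x))) ≡ 2 * (suc m * suc m) * ((2 * x) * (2 * x))
  regroup = solve-∀

infixl 5 _⊛_
_⊛_ : ∀ {A B : Set} → List (A → B) → List A → List B
fs ⊛ xs = cartesianProductWith _$_ fs xs

∈-⊛ : ∀ {A B : Set} {f : A → B} {x fs xs} → f ∈ fs → x ∈ xs → f x ∈ fs ⊛ xs
∈-⊛ = ∈-cartesianProductWith⁺ _$_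

length-cartesianProductWith : ∀ {A B C : Set} (f : A → B → C) (xs : List A) (ys : List B) →
  length (cartesianProductWith f xs ys) ≡ length xs * length ys
length-cartesianProductWith f []       ys = refl
length-cartesianProductWith f (x ∷ xs) ys = begin
  length (map (f x) ys ++ cartesianProductWith f xs ys)          ≡⟨ length-++ (map (f x) ys) ⟩
  length (map (f x) ys) + length (cartesianProductWith f xs ys)  ≡⟨ cong₂ _+_ (length-map (f x) ys) (length-cartesianProductWith f xs ys) ⟩
  length ys + length xs * length ys                              ∎
  where open ≡-Reasoning

length-⊛ : ∀ {A B : Set} (fs : List (A → B)) (xs : List A) → length (fs ⊛ xs) ≡ length fs * length xs
length-⊛ = length-cartesianProductWith _$_

length-⊛⁴ : ∀ {A B C D E : Set} (fs : List (A → B → C → D → E)) (as : List A) (bs : List B)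
            (cs : List C) (ds : List D) →
            length (fs ⊛ as ⊛ bs ⊛ cs ⊛ ds) ≡ length fs * length as * length bs * length cs * length ds
length-⊛⁴ fs as bs cs ds = begin
  length (fs ⊛ as ⊛ bs ⊛ cs ⊛ ds)                              ≡⟨ length-⊛ (fs ⊛ as ⊛ bs ⊛ cs) ds ⟩
  length (fs ⊛ as ⊛ bs ⊛ cs) * length ds                       ≡⟨ cong (_* length ds) (length-⊛ (fs ⊛ as ⊛ bs) cs) ⟩
  length (fs ⊛ as ⊛ bs) * length cs * length ds                ≡⟨ cong (λ x → x * length cs * length ds) (length-⊛ (fs ⊛ as) bs) ⟩
  length (fs ⊛ as) * length bs * length cs * length ds         ≡⟨ cong (λ x → x * length bs * length cs * length ds) (length-⊛ fs as) ⟩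
  length fs * length as * length bs * length cs * length ds    ∎
  where open ≡-Reasoning

-- The truth table of a Boolean function of n variables, as a complete binary
-- tree: `node f₀ f₁` branches on the value of the first variable.
data Table : ℕ → Set where
  leaf : Bool → Table 0
  node : Table n → Table n → Table (suc n)

lookupᵗ : Table n → Vec Bool n → Bool
lookupᵗ (leaf b)     []          = b
lookupᵗ (node f₀ f₁) (false ∷ v) = lookupᵗ f₀ v
lookupᵗ (node f₀ f₁) (true  ∷ v) = lookupᵗ f₁ v

tabulateᵗ : (Vec Bool n → Bool) → Table n
tabulateᵗ {zero}  f = leaf (f [])
tabulateᵗ {suc n} f = node (tabulateᵗ (λ v → f (false ∷ v))) (tabulateᵗ (λ v → f (true ∷ v)))

lookup-tabulateᵗ : (f : Vec Bool n → Bool) (v : Vec Bool n) → lookupᵗ (tabulateᵗ f) v ≡ f v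
lookup-tabulateᵗ f []          = refl
lookup-tabulateᵗ f (false ∷ v) = lookup-tabulateᵗ (λ w → f (false ∷ w)) v
lookup-tabulateᵗ f (true  ∷ v) = lookup-tabulateᵗ (λ w → f (true ∷ w)) v

data _⊑_ : Table n → Table n → Set where
  leaf : ∀ {a b} → a ≤ᴮ b → leaf a ⊑ leaf b
  node : ∀ {f₀ f₁ g₀ g₁ : Table n} → f₀ ⊑ g₀ → f₁ ⊑ g₁ → node f₀ f₁ ⊑ node g₀ g₁

_⊑?_ : (f g : Table n) → Dec (f ⊑ g)
leaf a ⊑? leaf b = map′ leaf (λ { (leaf a≤b) → a≤b }) (a Boolₚ.≤? b)
node f₀ f₁ ⊑? node g₀ g₁ =
  map′ (uncurry node) (λ { (node p q) → p , q }) ((f₀ ⊑? g₀) ×-dec (f₁ ⊑? g₁))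

tabulate-⊑ : (f g : Vec Bool n → Bool) → (∀ v → f v ≤ᴮ g v) → tabulateᵗ f ⊑ tabulateᵗ g
tabulate-⊑ {zero}  f g f≤g = leaf (f≤g [])
tabulate-⊑ {suc n} f g f≤g =
  node (tabulate-⊑ _ _ (λ v → f≤g (false ∷ v))) (tabulate-⊑ _ _ (λ v → f≤g (true ∷ v)))

Monotone : (Vec Bool n → Bool) → Set
Monotone f = ∀ {u v} → Pointwise _≤ᴮ_ u v → f u ≤ᴮ f v

-- A table is monotone iff both halves are monotone and the false-half lies
-- below the true-half; this recursion lists all monotone tables.
monotoneTables : (n : ℕ) → List (Table n)
monotoneTables zero    = leaf false ∷ leaf true ∷ []
monotoneTables (suc n) =
  map (uncurry node) (filter (uncurry _⊑?_) (cartesianProduct (monotoneTables n) (monotoneTables n)))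

monotone-listed : (f : Vec Bool n → Bool) → Monotone f → tabulateᵗ f ∈ monotoneTables n
monotone-listed {zero}  f _ with f []
... | false = here refl
... | true  = there (here refl)
monotone-listed {suc n} f mono =
  ∈-map⁺ (uncurry node)
    (∈-filter⁺ (uncurry _⊑?_)
      (∈-cartesianProduct⁺ (monotone-listed f₀ (λ u≤v → mono (b≤b ∷ u≤v)))
                           (monotone-listed f₁ (λ u≤v → mono (b≤b ∷ u≤v))))
      (tabulate-⊑ f₀ f₁ (λ v → mono (f≤t ∷ Pointwise.refl Boolₚ.≤-refl))))
  where
  f₀ f₁ : Vec Bool n → Bool
  f₀ v = f (false ∷ v)
  f₁ v = f (true ∷ v)

monotoneTables-count : length (monotoneTables 4) ≡ 168
monotoneTables-count = refl

swap₀₁ : Vec Bool (suc (suc n)) → Vec Bool (suc (suc n))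
swap₀₁ (a ∷ b ∷ v) = b ∷ a ∷ v

swap₂₃ : Vec Bool 4 → Vec Bool 4
swap₂₃ (a ∷ b ∷ v) = a ∷ b ∷ swap₀₁ v

-- The same swaps on tables; swap₀₁ᵗ (tabulateᵗ f) is tabulateᵗ (f ∘ swap₀₁)
-- by computation, and similarly for swap₂₃ᵗ.
swap₀₁ᵗ : Table (suc (suc n)) → Table (suc (suc n))
swap₀₁ᵗ (node (node f₀₀ f₀₁) (node f₁₀ f₁₁)) = node (node f₀₀ f₁₀) (node f₀₁ f₁₁)

swap₂₃ᵗ : Table 4 → Table 4
swap₂₃ᵗ (node (node f₀₀ f₀₁) (node f₁₀ f₁₁)) =
  node (node (swap₀₁ᵗ f₀₀) (swap₀₁ᵗ f₀₁)) (node (swap₀₁ᵗ f₁₀) (swap₀₁ᵗ f₁₁))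

-- Tables invariant under both swaps.  As the swaps are involutions,
-- t ⊑ swap t already forces t = swap t.
symmetric? : (t : Table 4) → Dec ((t ⊑ swap₀₁ᵗ t) × (t ⊑ swap₂₃ᵗ t))
symmetric? t = (t ⊑? swap₀₁ᵗ t) ×-dec (t ⊑? swap₂₃ᵗ t)

symmetricTables : List (Table 4)
symmetricTables = filter symmetric? (monotoneTables 4)

symmetric-listed : (f : Vec Bool 4 → Bool) → Monotone f →
                   (∀ v → f v ≡ f (swap₀₁ v)) → (∀ v → f v ≡ f (swap₂₃ v)) →
                   tabulateᵗ f ∈ symmetricTables
symmetric-listed f mono sym₀₁ sym₂₃ =
  ∈-filter⁺ symmetric? (monotone-listed f mono)
    ( tabulate-⊑ f (λ v → f (swap₀₁ v)) (λ v → Boolₚ.≤-reflexive (sym₀₁ v))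
    , tabulate-⊑ f (λ v → f (swap₂₃ v)) (λ v → Boolₚ.≤-reflexive (sym₂₃ v)))

symmetricTables-count : length symmetricTables ≡ 20
symmetricTables-count = refl

dirSet : Vec Bool 4 → DirSet
dirSet (n ∷ s ∷ e ∷ w ∷ []) N = n
dirSet (n ∷ s ∷ e ∷ w ∷ []) S = s
dirSet (n ∷ s ∷ e ∷ w ∷ []) E = e
dirSet (n ∷ s ∷ e ∷ w ∷ []) W = w

dirVec : DirSet → Vec Bool 4
dirVec D = D N ∷ D S ∷ D E ∷ D W ∷ []

threshold : (Glue → ℕ) → ℕ → TileType → DirSet → Bool
threshold g τ t D = does (τ ≤? strengthSum g t D)

-- A Boolean that is true exactly when P holds is the decision of P; so an
-- implementable cooperation set is the threshold function.
⇔-does : ∀ {P : Set} {b : Bool} → (b ≡ true ⇔ P) → (P? : Dec P) → b ≡ does P?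
⇔-does {b = true}  b⇔P (yes _) = refl
⇔-does {b = true}  b⇔P (no ¬P) = contradiction (Equivalence.to b⇔P refl) ¬P
⇔-does {b = false} b⇔P (yes P) = Equivalence.from b⇔P P
⇔-does {b = false} b⇔P (no _)  = refl

does-mono : ∀ {P Q : Set} → (P → Q) → (P? : Dec P) (Q? : Dec Q) → does P? ≤ᴮ does Q?
does-mono P⇒Q (yes _) (yes _) = b≤b
does-mono P⇒Q (yes P) (no ¬Q) = contradiction (P⇒Q P) ¬Q
does-mono P⇒Q (no _)  (yes _) = f≤t
does-mono P⇒Q (no _)  (no _)  = b≤b

if-mono : ∀ {a b} x → a ≤ᴮ b → (if a then x else 0) ≤ (if b then x else 0)
if-mono x f≤t = z≤n
if-mono x b≤b = ≤-refl

strengthSum-mono : ∀ g t {u v : Vec Bool 4} → Pointwise _≤ᴮ_ u v →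
                   strengthSum g t (dirSet u) ≤ strengthSum g t (dirSet v)
strengthSum-mono g t (n ∷ s ∷ e ∷ w ∷ []) =
  +-mono-≤ (+-mono-≤ (+-mono-≤ (if-mono _ n) (if-mono _ s)) (if-mono _ e)) (if-mono _ w)

threshold-monotone : ∀ g τ t → Monotone (λ v → threshold g τ t (dirSet v))
threshold-monotone g τ t {u} {v} u≤v =
  does-mono (λ τ≤ → ≤-trans τ≤ (strengthSum-mono g t u≤v))
            (τ ≤? strengthSum g t (dirSet u)) (τ ≤? strengthSum g t (dirSet v))

strengthSum-swapNS : ∀ g t → t N ≡ t S → ∀ v →
                     strengthSum g t (dirSet v) ≡ strengthSum g t (dirSet (swap₀₁ v))
strengthSum-swapNS g t N≡S (n ∷ s ∷ e ∷ w ∷ []) rewrite N≡S =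
  swap-first-two (if n then g (t S) else 0) (if s then g (t S) else 0)
                 (if e then g (t E) else 0) (if w then g (t W) else 0)
  where
  swap-first-two : ∀ x y z u → x + y + z + u ≡ y + x + z + u
  swap-first-two = solve-∀

strengthSum-swapEW : ∀ g t → t E ≡ t W → ∀ v →
                     strengthSum g t (dirSet v) ≡ strengthSum g t (dirSet (swap₂₃ v))
strengthSum-swapEW g t E≡W (n ∷ s ∷ e ∷ w ∷ []) rewrite E≡W =
  swap-last-two (if n then g (t N) else 0) (if s then g (t S) else 0)
                (if e then g (t W) else 0) (if w then g (t W) else 0)
  where
  swap-last-two : ∀ x y z u → x + y + z + u ≡ x + y + u + z
  swap-last-two = solve-∀

thresholdTable : (Glue → ℕ) → ℕ → TileType → Table 4
thresholdTable g τ t = tabulateᵗ (λ v → threshold g τ t (dirSet v))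

lookup-thresholdTable : ∀ g τ t D → lookupᵗ (thresholdTable g τ t) (dirVec D) ≡ threshold g τ t D
lookup-thresholdTable g τ t D = lookup-tabulateᵗ (λ v → threshold g τ t (dirSet v)) (dirVec D)

tablesFor : ℕ → List (Table 4)
tablesFor (suc zero) = symmetricTables
tablesFor _          = monotoneTables 4

tablesFor-length : ∀ n → length (tablesFor n) ≤ 168
tablesFor-length zero          = ≤-reflexive monotoneTables-count
tablesFor-length (suc zero)    = ≤-trans (≤-reflexive symmetricTables-count) (m≤m+n 20 148)
tablesFor-length (suc (suc _)) = ≤-reflexive monotoneTables-count

thresholdTable-listed : ∀ n g τ t → (n ≡ 1 → t N ≡ t S × t E ≡ t W) → thresholdTable g τ t ∈ tablesFor n
thresholdTable-listed zero          g τ t _ = monotone-listed _ (threshold-monotone g τ t)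
thresholdTable-listed (suc (suc _)) g τ t _ = monotone-listed _ (threshold-monotone g τ t)
thresholdTable-listed (suc zero)    g τ t single with single refl
... | N≡S , E≡W = symmetric-listed _ (threshold-monotone g τ t)
  (λ v → cong (λ s → does (τ ≤? s)) (strengthSum-swapNS g t N≡S v))
  (λ v → cong (λ s → does (τ ≤? s)) (strengthSum-swapEW g t E≡W v))

-- Position of the first occurrence of x in the list, or (length + x) when x
-- does not occur: an injective relabelling of glues that gives small labels
-- to glues occurring early in the list.
firstIndex : Glue → List Glue → ℕ
firstIndex x []       = x
firstIndex x (y ∷ ys) with x ℕ.≟ y
... | yes _ = 0
... | no  _ = suc (firstIndex x ys)

firstIndex-injective : ∀ ys {x y} → firstIndex x ys ≡ firstIndex y ys → x ≡ y
firstIndex-injective []       same = same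
firstIndex-injective (z ∷ zs) {x} {y} same with x ℕ.≟ z | y ℕ.≟ z
... | yes x≡z | yes y≡z = trans x≡z (sym y≡z)
... | no  _   | no  _   = firstIndex-injective zs (suc-injective same)
firstIndex-injective (z ∷ zs) () | yes _ | no _
firstIndex-injective (z ∷ zs) () | no _  | yes _

firstIndex-head : ∀ x ys → firstIndex x (x ∷ ys) ≡ 0
firstIndex-head x ys with x ℕ.≟ x
... | yes _  = refl
... | no x≢x = contradiction refl x≢x

firstIndex-∷ : ∀ x y ys → firstIndex x (y ∷ ys) ≤ suc (firstIndex x ys)
firstIndex-∷ x y ys with x ℕ.≟ y
... | yes _ = z≤n
... | no  _ = ≤-refl

firstIndex-skip₂ : ∀ x a b ys → firstIndex x (a ∷ b ∷ ys) ≤ 2 + firstIndex x ys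
firstIndex-skip₂ x a b ys = ≤-trans (firstIndex-∷ x a (b ∷ ys)) (s≤s (firstIndex-∷ x b ys))

glueSeq : ∀ {r} → Vec TileType r → List Glue
glueSeq []       = []
glueSeq (t ∷ ts) = t N ∷ t E ∷ glueSeq ts

-- The north glue of tile j sits at position 2j of the glue sequence and its
-- east glue at position 2j+1, so their first occurrences are no later.
firstIndex-north : ∀ {r} (ts : Vec TileType r) j → firstIndex (lookup ts j N) (glueSeq ts) ≤ 2 * toℕ j
firstIndex-north (t ∷ ts) zero    = ≤-reflexive (firstIndex-head (t N) (t E ∷ glueSeq ts))
firstIndex-north (t ∷ ts) (suc j) = ≤-trans (firstIndex-skip₂ _ (t N) (t E) (glueSeq ts))
  (≤-trans (+-monoʳ-≤ 2 (firstIndex-north ts j)) (≤-reflexive (sym (*-suc 2 (toℕ j)))))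

firstIndex-east : ∀ {r} (ts : Vec TileType r) j → firstIndex (lookup ts j E) (glueSeq ts) ≤ 1 + 2 * toℕ j
firstIndex-east (t ∷ ts) zero    = ≤-trans (firstIndex-∷ (t E) (t N) (t E ∷ glueSeq ts))
  (s≤s (≤-reflexive (firstIndex-head (t E) (glueSeq ts))))
firstIndex-east (t ∷ ts) (suc j) = ≤-trans (firstIndex-skip₂ _ (t N) (t E) (glueSeq ts))
  (≤-trans (+-monoʳ-≤ 2 (firstIndex-east ts j)) (≤-reflexive (cong suc (sym (*-suc 2 (toℕ j))))))

-- The code of one tile of an n-tile TAS: its north and east glue labels,
-- the tiles whose north (east) glue is its south (west) glue, and the truth
-- table of its cooperation set.
record TileCode (n : ℕ) : Set where
  constructor tileCode
  field
    northLabel : Glue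
    southPeer  : Fin n
    eastLabel  : Glue
    westPeer   : Fin n
    table      : Table 4
open TileCode

decodeTile : Vec (TileCode n) n → Fin n → TileType
decodeTile c i N = northLabel (lookup c i)
decodeTile c i S = northLabel (lookup c (southPeer (lookup c i)))
decodeTile c i E = eastLabel (lookup c i)
decodeTile c i W = eastLabel (lookup c (westPeer (lookup c i)))

Distinct : (Fin n → TileType) → Set
Distinct t = ∀ i j → (∀ d → t i d ≡ t j d) → i ≡ j

∀-dir? : {P : Dir → Set} → (∀ d → Dec (P d)) → Dec (∀ d → P d)
∀-dir? P? = map′ (λ { (n , s , e , w) → λ { N → n ; S → s ; E → e ; W → w } })
                 (λ P → P N , P S , P E , P W)
                 (P? N ×-dec P? S ×-dec P? E ×-dec P? W)

distinct? : (t : Fin n → TileType) → Dec (Distinct t)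
distinct? t = all? λ i → all? λ j → ∀-dir? (λ d → t i d ℕ.≟ t j d) →-dec (i ≟ᶠ j)

-- A fixed TAS returned for codes whose tiles are not distinct.
oneTile : SFTAS
oneTile = record { size = 1 ; tile = λ _ _ → 0 ; distinct = λ { zero zero _ → refl }
                 ; seed = zero ; coop = λ _ _ → false }

decodeWith : (c : Vec (TileCode n) n) → Fin n → Dec (Distinct (decodeTile c)) → SFTAS
decodeWith {n} c s (yes tiles-distinct) = record
  { size = n ; tile = decodeTile c ; distinct = tiles-distinct ; seed = s
  ; coop = λ i D → lookupᵗ (table (lookup c i)) (dirVec D) }
decodeWith c s (no _) = oneTile

decode : Vec (TileCode n) n → Fin n → SFTAS
decode c s = decodeWith c s (distinct? (decodeTile c))

decode-equiv : (𝒯 : SFTAS) (c : Vec (TileCode (size 𝒯)) (size 𝒯))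
               (ρ : Glue → Glue) → Injective _≡_ _≡_ ρ → (π : Permutation (size 𝒯) (size 𝒯)) →
               (∀ i d → decodeTile c (π ⟨$⟩ʳ i) d ≡ ρ (tile 𝒯 i d)) →
               (∀ i D → lookupᵗ (table (lookup c (π ⟨$⟩ʳ i))) (dirVec D) ≡ coop 𝒯 i D) →
               Equiv 𝒯 (decode c (π ⟨$⟩ʳ seed 𝒯))
decode-equiv 𝒯 c ρ ρ-injective π tiles coops = from-decision (distinct? (decodeTile c))
  where
  tiles′ : ∀ j d → decodeTile c j d ≡ ρ (tile 𝒯 (π ⟨$⟩ˡ j) d)
  tiles′ j d = subst (λ k → decodeTile c k d ≡ ρ (tile 𝒯 (π ⟨$⟩ˡ j) d)) (inverseʳ π) (tiles (π ⟨$⟩ˡ j) d)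

  decoded-distinct : Distinct (decodeTile c)
  decoded-distinct i j i≈j = begin
    i                      ≡⟨ inverseʳ π ⟨
    π ⟨$⟩ʳ (π ⟨$⟩ˡ i)      ≡⟨ cong (π ⟨$⟩ʳ_) (distinct 𝒯 _ _ same-tile) ⟩
    π ⟨$⟩ʳ (π ⟨$⟩ˡ j)      ≡⟨ inverseʳ π ⟩
    j                      ∎
    where
    open ≡-Reasoning
    same-tile : ∀ d → tile 𝒯 (π ⟨$⟩ˡ i) d ≡ tile 𝒯 (π ⟨$⟩ˡ j) d
    same-tile d = ρ-injective (trans (sym (tiles′ i d)) (trans (i≈j d) (tiles′ j d)))

  from-decision : (d : Dec (Distinct (decodeTile c))) → Equiv 𝒯 (decodeWith c (π ⟨$⟩ʳ seed 𝒯) d)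
  from-decision (yes _)    = ρ , ρ-injective , π , tiles , refl , coops
  from-decision (no ¬dist) = contradiction decoded-distinct ¬dist

tileCodes : (n : ℕ) → List (Table 4) → ℕ → List (TileCode n)
tileCodes n tables m =
  map tileCode (upTo (1 + 2 * m)) ⊛ allFin n ⊛ upTo (2 + 2 * m) ⊛ allFin n ⊛ tables

tileCode-listed : ∀ {tables m a s e w t} → a < 1 + 2 * m → e < 2 + 2 * m → t ∈ tables →
                  tileCode a s e w t ∈ tileCodes n tables m
tileCode-listed a< e< t∈ =
  ∈-⊛ (∈-⊛ (∈-⊛ (∈-⊛ (∈-map⁺ tileCode (∈-upTo⁺ a<)) (∈-allFin _)) (∈-upTo⁺ e<)) (∈-allFin _)) t∈

length-tileCodes : ∀ n tables m →
  length (tileCodes n tables m) ≡ (1 + 2 * m) * (2 + 2 * m) * (n * n * length tables)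
length-tileCodes n tables m = begin
  length (tileCodes n tables m)
    ≡⟨ length-⊛⁴ (map (tileCode {n}) (upTo (1 + 2 * m))) (allFin n) (upTo (2 + 2 * m)) (allFin n) tables ⟩
  length (map (tileCode {n}) (upTo (1 + 2 * m))) * length (allFin n) * length (upTo (2 + 2 * m))
    * length (allFin n) * length tables
    ≡⟨ cong (λ x → x * length (allFin n) * length (upTo (2 + 2 * m)) * length (allFin n) * length tables)
            (trans (length-map (tileCode {n}) (upTo (1 + 2 * m))) (length-upTo (1 + 2 * m))) ⟩
  (1 + 2 * m) * length (allFin n) * length (upTo (2 + 2 * m)) * length (allFin n) * length tables
    ≡⟨ cong₂ (λ x y → (1 + 2 * m) * x * y * x * length tables)
             (length-tabulate {n = n} (λ i → i)) (length-upTo (2 + 2 * m)) ⟩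
  (1 + 2 * m) * n * (2 + 2 * m) * n * length tables
    ≡⟨ regroup (1 + 2 * m) (2 + 2 * m) n (length tables) ⟩
  (1 + 2 * m) * (2 + 2 * m) * (n * n * length tables) ∎
  where
  open ≡-Reasoning
  regroup : ∀ a e n t → a * n * e * n * t ≡ a * e * (n * n * t)
  regroup = solve-∀

codesFrom : (n : ℕ) → List (Table 4) → (m r : ℕ) → List (Vec (TileCode n) r)
codesFrom n tables m zero    = [] ∷ []
codesFrom n tables m (suc r) =
  cartesianProductWith _∷_ (tileCodes n tables m) (codesFrom n tables (suc m) r)

codesFrom-complete : ∀ {n tables} m r (f : Fin r → TileCode n) →
                     (∀ j → f j ∈ tileCodes n tables (m + toℕ j)) →
                     tabulate f ∈ codesFrom n tables m r
codesFrom-complete m zero    f listed = here refl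
codesFrom-complete {n} {tables} m (suc r) f listed =
  ∈-cartesianProductWith⁺ _∷_
    (subst (λ k → f zero ∈ tileCodes n tables k) (+-identityʳ m) (listed zero))
    (codesFrom-complete (suc m) r (λ j → f (suc j))
      (λ j → subst (λ k → f (suc j) ∈ tileCodes n tables k) (+-suc m (toℕ j)) (listed (suc j))))

length-codesFrom : ∀ n tables m r →
  length (codesFrom n tables m r) * (2 * m) ! ≡ (2 * (m + r)) ! * (n * n * length tables) ^ r
length-codesFrom n tables m zero =
  trans (+-identityʳ ((2 * m) !)) (sym (trans (*-identityʳ _) (cong (λ k → (2 * k) !) (+-identityʳ m))))
length-codesFrom n tables m (suc r) = begin
  length (codesFrom n tables m (suc r)) * (2 * m) !
    ≡⟨ cong (_* (2 * m) !) (length-cartesianProductWith _∷_ (tileCodes n tables m) (codesFrom n tables (suc m) r)) ⟩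
  length (tileCodes n tables m) * L * (2 * m) !
    ≡⟨ cong (λ x → x * L * (2 * m) !) (length-tileCodes n tables m) ⟩
  (1 + 2 * m) * (2 + 2 * m) * t * L * (2 * m) !
    ≡⟨ regroup (1 + 2 * m) (2 + 2 * m) t L ((2 * m) !) ⟩
  t * (L * ((2 + 2 * m) * ((1 + 2 * m) * (2 * m) !)))
    ≡⟨ cong (λ x → t * (L * x)) (double-factorial-suc m) ⟨
  t * (L * (2 * suc m) !)
    ≡⟨ cong (t *_) (length-codesFrom n tables (suc m) r) ⟩
  t * ((2 * (suc m + r)) ! * t ^ r)
    ≡⟨ cong (λ k → t * ((2 * k) ! * t ^ r)) (+-suc m r) ⟨
  t * ((2 * (m + suc r)) ! * t ^ r)
    ≡⟨ *-left-commute t ((2 * (m + suc r)) !) (t ^ r) ⟩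
  (2 * (m + suc r)) ! * t ^ suc r ∎
  where
  open ≡-Reasoning
  t = n * n * length tables
  L = length (codesFrom n tables (suc m) r)
  regroup : ∀ a e t L f → a * e * t * L * f ≡ t * (L * (e * (a * f)))
  regroup = solve-∀

codes : (n : ℕ) → List (Vec (TileCode n) n)
codes n = codesFrom n (tablesFor n) 0 n

length-codes : ∀ n → length (codes n) ≡ (2 * n) ! * (n * n * length (tablesFor n)) ^ n
length-codes n = trans (sym (*-identityʳ (length (codes n)))) (length-codesFrom n (tablesFor n) 0 n)

transpose-source : ∀ {n} (i j : Fin n) → transpose i j ⟨$⟩ʳ i ≡ j
transpose-source i j rewrite dec-true (i ≟ᶠ i) refl = refl

Fin1-unique : n ≡ 1 → (i j : Fin n) → i ≡ j
Fin1-unique refl zero zero = refl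

module Canonical (𝒯 : SFTAS) (standing : StandingAssumption 𝒯) (g : Glue → ℕ) (τ : ℕ)
                 (coop≡threshold : ∀ i D → coop 𝒯 i D ≡ threshold g τ (tile 𝒯 i) D)
                 (π : Permutation (size 𝒯) (size 𝒯)) where

  peer : Fin (size 𝒯) → Dir → Fin (size 𝒯)
  peer i d = proj₁ (standing i d)

  ordered : Vec TileType (size 𝒯)
  ordered = tabulate (λ j → tile 𝒯 (π ⟨$⟩ˡ j))

  label : Glue → Glue
  label x = firstIndex x (glueSeq ordered)

  codeOf : Fin (size 𝒯) → TileCode (size 𝒯)
  codeOf i = tileCode (label (tile 𝒯 i N)) (π ⟨$⟩ʳ peer i S) (label (tile 𝒯 i E)) (π ⟨$⟩ʳ peer i W)
                      (thresholdTable g τ (tile 𝒯 i))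

  canonical : Vec (TileCode (size 𝒯)) (size 𝒯)
  canonical = tabulate (λ j → codeOf (π ⟨$⟩ˡ j))

  lookup-canonical : ∀ i → lookup canonical (π ⟨$⟩ʳ i) ≡ codeOf i
  lookup-canonical i = trans (lookup∘tabulate _ (π ⟨$⟩ʳ i)) (cong codeOf (inverseˡ π))

  peer-label : ∀ i d → label (tile 𝒯 (peer i d) (opp d)) ≡ label (tile 𝒯 i d)
  peer-label i d = cong label (proj₂ (standing i d))

  decodeTile-canonical : ∀ i d → decodeTile canonical (π ⟨$⟩ʳ i) d ≡ label (tile 𝒯 i d)
  decodeTile-canonical i N = cong northLabel (lookup-canonical i)
  decodeTile-canonical i E = cong eastLabel (lookup-canonical i)
  decodeTile-canonical i S = begin
    northLabel (lookup canonical (southPeer (lookup canonical (π ⟨$⟩ʳ i))))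
      ≡⟨ cong (λ c → northLabel (lookup canonical (southPeer c))) (lookup-canonical i) ⟩
    northLabel (lookup canonical (π ⟨$⟩ʳ peer i S))
      ≡⟨ cong northLabel (lookup-canonical (peer i S)) ⟩
    label (tile 𝒯 (peer i S) N)
      ≡⟨ peer-label i S ⟩
    label (tile 𝒯 i S) ∎
    where open ≡-Reasoning
  decodeTile-canonical i W = begin
    eastLabel (lookup canonical (westPeer (lookup canonical (π ⟨$⟩ʳ i))))
      ≡⟨ cong (λ c → eastLabel (lookup canonical (westPeer c))) (lookup-canonical i) ⟩
    eastLabel (lookup canonical (π ⟨$⟩ʳ peer i W))
      ≡⟨ cong eastLabel (lookup-canonical (peer i W)) ⟩
    label (tile 𝒯 (peer i W) E)
      ≡⟨ peer-label i W ⟩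
    label (tile 𝒯 i W) ∎
    where open ≡-Reasoning

  coop-canonical : ∀ i D → lookupᵗ (table (lookup canonical (π ⟨$⟩ʳ i))) (dirVec D) ≡ coop 𝒯 i D
  coop-canonical i D = begin
    lookupᵗ (table (lookup canonical (π ⟨$⟩ʳ i))) (dirVec D)
      ≡⟨ cong (λ c → lookupᵗ (table c) (dirVec D)) (lookup-canonical i) ⟩
    lookupᵗ (thresholdTable g τ (tile 𝒯 i)) (dirVec D)
      ≡⟨ lookup-thresholdTable g τ (tile 𝒯 i) D ⟩
    threshold g τ (tile 𝒯 i) D
      ≡⟨ coop≡threshold i D ⟨
    coop 𝒯 i D ∎
    where open ≡-Reasoning

  canonical-equiv : Equiv 𝒯 (decode canonical (π ⟨$⟩ʳ seed 𝒯))
  canonical-equiv = decode-equiv 𝒯 canonical label (firstIndex-injective (glueSeq ordered)) π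
                                 decodeTile-canonical coop-canonical

  -- A single tile is its own peer, so its opposite glues agree.
  single-tile-symmetric : ∀ i → size 𝒯 ≡ 1 → tile 𝒯 i N ≡ tile 𝒯 i S × tile 𝒯 i E ≡ tile 𝒯 i W
  single-tile-symmetric i single = own-peer S , own-peer W
    where
    own-peer : ∀ d → tile 𝒯 i (opp d) ≡ tile 𝒯 i d
    own-peer d = trans (cong (λ j → tile 𝒯 j (opp d)) (Fin1-unique single i (peer i d))) (proj₂ (standing i d))

  canonical-listed : canonical ∈ codes (size 𝒯)
  canonical-listed = codesFrom-complete 0 (size 𝒯) (λ j → codeOf (π ⟨$⟩ˡ j)) λ j →
    tileCode-listed {m = toℕ j} (s≤s (north-bound j)) (s≤s (east-bound j))
      (thresholdTable-listed (size 𝒯) g τ (tile 𝒯 (π ⟨$⟩ˡ j)) (single-tile-symmetric (π ⟨$⟩ˡ j)))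
    where
    north-bound : ∀ j → label (tile 𝒯 (π ⟨$⟩ˡ j) N) ≤ 2 * toℕ j
    north-bound j = subst (λ t → label (t N) ≤ 2 * toℕ j)
                          (lookup∘tabulate (λ k → tile 𝒯 (π ⟨$⟩ˡ k)) j) (firstIndex-north ordered j)
    east-bound : ∀ j → label (tile 𝒯 (π ⟨$⟩ˡ j) E) ≤ 1 + 2 * toℕ j
    east-bound j = subst (λ t → label (t E) ≤ 1 + 2 * toℕ j)
                         (lookup∘tabulate (λ k → tile 𝒯 (π ⟨$⟩ˡ k)) j) (firstIndex-east ordered j)

-- The decoded codes of n-tile TASs, with the seed first.
tasOfSize : ℕ → List SFTAS
tasOfSize zero    = []
tasOfSize (suc n) = map (λ c → decode c zero) (codes (suc n))

-- Every implementable TAS satisfying the standing assumption is listed up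
-- to equivalence: take its canonical code for the transposition that moves
-- the seed to the front.
listed : ∀ 𝒯 → StandingAssumption 𝒯 → Implementable 𝒯 → Any (Equiv 𝒯) (tasOfSize (size 𝒯))
listed 𝒯@record { size = suc n ; seed = s } standing (g , τ , _ , coop⇔) =
  lose (∈-map⁺ (λ c → decode c zero) canonical-listed)
       (subst (λ s′ → Equiv 𝒯 (decode canonical s′)) (transpose-source s zero) canonical-equiv)
  where
  open Canonical 𝒯 standing g τ (λ i D → ⇔-does (coop⇔ i D) (τ ≤? strengthSum g (tile 𝒯 i) D))
                 (transpose s zero)

sizeBound : ℕ → ℕ
sizeBound n = 2 * (n ^ 4 * 168) ^ n

sizeBound-mono : ∀ {n k} → 1 ≤ n → n ≤ k → sizeBound n ≤ sizeBound k
sizeBound-mono {suc _} {zero}  _ ()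
sizeBound-mono {n} {k@(suc _)} _ n≤k = *-monoʳ-≤ 2 (begin
  (n ^ 4 * 168) ^ n   ≤⟨ ^-monoˡ-≤ n (*-monoˡ-≤ 168 (^-monoˡ-≤ 4 n≤k)) ⟩
  (k ^ 4 * 168) ^ n   ≤⟨ ^-monoʳ-≤ (k ^ 4 * 168) {{m*n≢0 (k ^ 4) 168 {{m^n≢0 k 4}}}} n≤k ⟩
  (k ^ 4 * 168) ^ k   ∎)
  where open ≤-Reasoning

length-tasOfSize : ∀ n → length (tasOfSize n) ≤ sizeBound n
length-tasOfSize zero       = z≤n
length-tasOfSize n@(suc _) = begin
  length (map (λ c → decode c zero) (codes n))   ≡⟨ length-map (λ c → decode c zero) (codes n) ⟩
  length (codes n)                               ≡⟨ length-codes n ⟩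
  (2 * n) ! * (n * n * length (tablesFor n)) ^ n
    ≤⟨ *-mono-≤ (double-factorial-bound n) (^-monoˡ-≤ n (*-monoʳ-≤ (n * n) (tablesFor-length n))) ⟩
  2 * (n * n) ^ n * (n * n * 168) ^ n            ≡⟨ *-assoc 2 ((n * n) ^ n) ((n * n * 168) ^ n) ⟩
  2 * ((n * n) ^ n * (n * n * 168) ^ n)          ≡⟨ cong (2 *_) (^-distribʳ-* (n * n) (n * n * 168) n) ⟨
  2 * (n * n * (n * n * 168)) ^ n                ≡⟨ cong (λ x → 2 * x ^ n) (fourth-power n) ⟩
  sizeBound n                                    ∎
  where
  open ≤-Reasoning
  fourth-power : ∀ n → n * n * (n * n * 168) ≡ n * (n * (n * (n * 1))) * 168
  fourth-power = solve-∀

tasUpTo : ℕ → List SFTAS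
tasUpTo zero    = []
tasUpTo (suc k) = tasUpTo k ++ tasOfSize (suc k)

tasUpTo-complete : ∀ {P : SFTAS → Set} {n} k → n ≤ k → Any P (tasOfSize n) → Any P (tasUpTo k)
tasUpTo-complete zero    z≤n ()
tasUpTo-complete (suc k) n≤k p with m≤n⇒m<n∨m≡n n≤k
... | inj₁ n<k  = ++⁺ˡ (tasUpTo-complete k (s≤s⁻¹ n<k) p)
... | inj₂ refl = ++⁺ʳ (tasUpTo k) p

length-tasUpTo : ∀ j k → j ≤ k → length (tasUpTo j) ≤ j * sizeBound k
length-tasUpTo zero    k _   = z≤n
length-tasUpTo (suc j) k j<k = begin
  length (tasUpTo j ++ tasOfSize (suc j))           ≡⟨ length-++ (tasUpTo j) ⟩
  length (tasUpTo j) + length (tasOfSize (suc j))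
    ≤⟨ +-mono-≤ (length-tasUpTo j k (<⇒≤ j<k))
                (≤-trans (length-tasOfSize (suc j)) (sizeBound-mono (s≤s z≤n) j<k)) ⟩
  j * sizeBound k + sizeBound k                     ≡⟨ +-comm (j * sizeBound k) (sizeBound k) ⟩
  suc j * sizeBound k                               ∎
  where open ≤-Reasoning

-- For k ≥ 2, summing sizeBound over k sizes stays within 168^k k^(4k+2)
-- because 2k ≤ k².
sizes-bound : ∀ k → 2 ≤ k → k * sizeBound k ≤ 168 ^ k * k ^ (4 * k + 2)
sizes-bound k 2≤k = begin
  k * (2 * (k ^ 4 * 168) ^ k)         ≡⟨ cong (λ x → k * (2 * x)) (^-distribʳ-* (k ^ 4) 168 k) ⟩
  k * (2 * ((k ^ 4) ^ k * 168 ^ k))   ≡⟨ cong (λ x → k * (2 * (x * 168 ^ k))) (^-*-assoc k 4 k) ⟩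
  k * (2 * (k ^ (4 * k) * 168 ^ k))   ≡⟨ rearrange k (k ^ (4 * k)) (168 ^ k) ⟩
  168 ^ k * (k ^ (4 * k) * (k * 2))   ≤⟨ *-monoʳ-≤ (168 ^ k) (*-monoʳ-≤ (k ^ (4 * k)) (*-monoʳ-≤ k 2≤k)) ⟩
  168 ^ k * (k ^ (4 * k) * (k * k))   ≡⟨ cong (λ x → 168 ^ k * (k ^ (4 * k) * (k * x))) (*-identityʳ k) ⟨
  168 ^ k * (k ^ (4 * k) * k ^ 2)     ≡⟨ cong (168 ^ k *_) (^-distribˡ-+-* k (4 * k) 2) ⟨
  168 ^ k * k ^ (4 * k + 2)           ∎
  where
  open ≤-Reasoning
  rearrange : ∀ k x y → k * (2 * (x * y)) ≡ y * (x * (k * 2))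
  rearrange = solve-∀

-- For k = 1 the general estimate is too weak; a single tile has 2 label
-- patterns and one of the 20 symmetric tables.
single-tile-count : length (tasUpTo 1) ≡ 40
single-tile-count = refl

count-bound : ∀ k → 1 ≤ k → length (tasUpTo k) ≤ 168 ^ k * k ^ (4 * k + 2)
count-bound (suc zero)      _ = ≤-trans (≤-reflexive single-tile-count) (m≤m+n 40 128)
count-bound k@(suc (suc _)) _ = ≤-trans (length-tasUpTo k k ≤-refl) (sizes-bound k (s≤s (s≤s z≤n)))

proposition4p1 : ∀ (k : ℕ) → 1 ≤ k →
    AtMostImplementable (168 ^ k * k ^ (4 * k + 2)) k
proposition4p1 k 1≤k =
  tasUpTo k , count-bound k 1≤k ,
  λ 𝒯 size≤k standing implementable → tasUpTo-complete k size≤k (listed 𝒯 standing implementable)
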